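{- Let $\Gamma\vdash t:\sigma$ be derivable in system $\mathcal B$. If every multitype in the image of $\Gamma$ is inhabited, then there is a testing context $T$ such that $\emptyset\vdash T\langle t\rangle:\sigma$ is derivable in $\mathcal B$; in particular $\sigma$ is inhabited.
   Context: Terms: $t ::= x \mid t\,u \mid \lambda x.t \mid\ !t \mid \mathrm{der}(t) \mid t[x\backslash u]$. Testing contexts: $T ::= \langle\cdot\rangle \mid T\,s \mid (\lambda x.T)\,s$. Types $\sigma ::= \alpha \mid \mathcal M \mid \mathcal M\to\sigma$, multitypes $\mathcal M$ finite multisets of types, $[\,]$ the empty one. Environments map variables to multitypes, all but finitely many to $[\,]$; $+$ pointwise multiset union; image = set of non-empty values; $\emptyset$ the everywhere-empty environment. System $\mathcal B$: (var) $x:[\sigma]\vdash x:\sigma$; (abs) $\Gamma,x:\mathcal M\vdash t:\sigma\Rightarrow\Gamma\vdash\lambda x.t:\mathcal M\to\sigma$; (app) $\Gamma\vdash t:\mathcal M\to\sigma$, $\Delta\vdash u:\mathcal M\Rightarrow\Gamma+\Delta\vdash tu:\sigma$; (es) $\Gamma,x:\mathcal M\vdash t:\sigma$, $\Delta\vdash u:\mathcal M\Rightarrow\Gamma+\Delta\vdash t[x\backslash u]:\sigma$; (bg) $(\Gamma_i\vdash t:\sigma_i)_{i\in I}$ ($I$ finite, possibly empty) $\Rightarrow+_i\Gamma_i\vdash !t:[\sigma_i]_{i\in I}$; (dr) $\Gamma\vdash t:[\sigma]\Rightarrow\Gamma\vdash\mathrm{der}(t):\sigma$. A type (or multitype) $\sigma$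 is inhabited if $\emptyset\vdash u:\sigma$ is derivable for some term $u$. -}

module Defs where

open import Data.Nat using (ℕ)
open import Data.List using (List; []; _∷_; _++_)
open import Data.List.Relation.Binary.Permutation.Propositional using (_↭_)
open import Data.Product using (Σ; ∃; _×_; _,_)
open import Relation.Binary.PropositionalEquality using (_≡_; _≢_)
open import Relation.Nullary using (Dec; yes; no)
open import Data.Nat using (_≟_)

Var : Set
Var = ℕ

data Term : Set where
  var  : Var → Term
  app  : Term → Term → Term
  lam  : Var → Term → Term
  bang : Term → Term
  der  : Term → Term
  es   : Term → Var → Term → Term   -- es t x u  is  t[x\u]

data TCtx : Set where
  hole : TCtx
  tapp : TCtx → Term → TCtx
  tred : Var → TCtx → Term → TCtx   -- (λx.T) s

plug : TCtx → Term → Term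
plug hole         t = t
plug (tapp T s)   t = app (plug T t) s
plug (tred x T s) t = app (lam x (plug T t)) s

-- Types  σ ::= α | M | M → σ ;  multitypes are finite multisets of types,
-- represented by lists and considered up to the equivalence _≈M_ below
-- (permutation, with elements compared up to _≈T_).
data Ty : Set where
  atom : ℕ → Ty
  mul  : List Ty → Ty
  arr  : List Ty → Ty → Ty

MTy : Set
MTy = List Ty

mutual
  data _≈T_ : Ty → Ty → Set where
    atom≈ : ∀ {a} → atom a ≈T atom a
    mul≈  : ∀ {M N} → M ≈M N → mul M ≈T mul N
    arr≈  : ∀ {M N σ τ} → M ≈M N → σ ≈T τ → arr M σ ≈T arr N τ

  data _≈L_ : MTy → MTy → Set where
    []≈  : [] ≈L []
    ∷≈   : ∀ {σ τ M N} → σ ≈T τ → M ≈L N → (σ ∷ M) ≈L (τ ∷ N)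

  data _≈M_ : MTy → MTy → Set where
    perm≈ : ∀ {M P N} → M ≈L P → P ↭ N → M ≈M N

Env : Set
Env = Var → MTy

∅ : Env
∅ _ = []

_+E_ : Env → Env → Env
(Γ +E Δ) y = Γ y ++ Δ y

-- Γ with x set to []  (so that  Γ = (Γ ∖ x), x : Γ x )
_∖_ : Env → Var → Env
(Γ ∖ x) y with y ≟ x
... | yes _ = []
... | no  _ = Γ y

single : Var → Ty → Env
single x σ y with y ≟ x
... | yes _ = σ ∷ []
... | no  _ = []

_≈E_ : Env → Env → Set
Γ ≈E Δ = ∀ y → Γ y ≈M Δ y

-- System B.  The rule (conv) only makes judgments invariant under the
-- representation of multisets by lists.
mutual
  data _⊢_∶_ : Env → Term → Ty → Set where
    var  : ∀ {x σ} → single x σ ⊢ var x ∶ σ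
    abs  : ∀ {Γ x t σ} → Γ ⊢ t ∶ σ → (Γ ∖ x) ⊢ lam x t ∶ arr (Γ x) σ
    app  : ∀ {Γ Δ t u M σ} → Γ ⊢ t ∶ arr M σ → Δ ⊢ u ∶ mul M →
           (Γ +E Δ) ⊢ app t u ∶ σ
    es   : ∀ {Γ Δ t x u σ} → Γ ⊢ t ∶ σ → Δ ⊢ u ∶ mul (Γ x) →
           ((Γ ∖ x) +E Δ) ⊢ es t x u ∶ σ
    bg   : ∀ {Γ t M} → BgFam Γ t M → Γ ⊢ bang t ∶ mul M
    dr   : ∀ {Γ t σ} → Γ ⊢ t ∶ mul (σ ∷ []) → Γ ⊢ der t ∶ σ
    conv : ∀ {Γ Γ' t σ σ'} → Γ ⊢ t ∶ σ → Γ ≈E Γ' → σ ≈T σ' → Γ' ⊢ t ∶ σ'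

  data BgFam : Env → Term → MTy → Set where
    bnil  : ∀ {t} → BgFam ∅ t []
    bcons : ∀ {Γ Δ t σ M} → Γ ⊢ t ∶ σ → BgFam Δ t M → BgFam (Γ +E Δ) t (σ ∷ M)

Inhabited : Ty → Set
Inhabited σ = Σ Term (λ u → ∅ ⊢ u ∶ σ)

ImageInhabited : Env → Set
ImageInhabited Γ = ∀ x → Γ x ≢ [] → Inhabited (mul (Γ x))

-- Only finitely many variables carry a non-empty multitype in a derivable
-- judgment.  Each such x is removed from the environment by the redex
-- (λx.⟨·⟩) w, where w inhabits Γ x; when Γ x = [] any !s serves as w, typed
-- by the empty family of the bang rule.  Doing this for the whole support
-- leaves the empty environment.
module Submission where

open import Defs
open import Data.Empty using (⊥-elim)
open import Data.List using (List; []; _∷_; _++_)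
open import Data.List.Properties using (++-identityʳ)
open import Data.List.Membership.Propositional using (_∈_)
open import Data.List.Membership.Propositional.Properties using (∈-++⁺ˡ; ∈-++⁺ʳ)
open import Data.List.Relation.Binary.Permutation.Propositional using (↭-refl; ↭-sym)
open import Data.List.Relation.Binary.Permutation.Propositional.Properties using (↭-empty-inv)
open import Data.List.Relation.Unary.Any using (here; there)
open import Data.Nat using (_≟_)
open import Data.Product using (Σ; ∃; _×_; _,_)
open import Data.Sum using (_⊎_; inj₁; inj₂; map₁; map₂)
open import Relation.Binary.PropositionalEquality using (_≡_; refl; sym; cong; cong₂; subst)
open import Relation.Nullary using (yes; no)

mutual
  ≈T-refl : ∀ σ → σ ≈T σ
  ≈T-refl (atom a)  = atom≈
  ≈T-refl (mul M)   = mul≈ (≈M-refl M)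
  ≈T-refl (arr M σ) = arr≈ (≈M-refl M) (≈T-refl σ)

  ≈L-refl : ∀ M → M ≈L M
  ≈L-refl []      = []≈
  ≈L-refl (σ ∷ M) = ∷≈ (≈T-refl σ) (≈L-refl M)

  ≈M-refl : ∀ M → M ≈M M
  ≈M-refl M = perm≈ (≈L-refl M) ↭-refl

≡⇒≈M : ∀ {M N} → M ≡ N → M ≈M N
≡⇒≈M {M} refl = ≈M-refl M

≈M-[] : ∀ {M N} → M ≈M N → M ≡ [] → N ≡ []
≈M-[] (perm≈ []≈ p) refl = ↭-empty-inv (↭-sym p)

SupportedIn : Env → List Var → Set
SupportedIn Γ L = ∀ y → Γ y ≡ [] ⊎ y ∈ L

single-support : ∀ x σ → SupportedIn (single x σ) (x ∷ [])
single-support x σ y with y ≟ x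
... | yes y≡x = inj₂ (here y≡x)
... | no _    = inj₁ refl

+E-support : ∀ {Γ Δ L K} → SupportedIn Γ L → SupportedIn Δ K →
             SupportedIn (Γ +E Δ) (L ++ K)
+E-support {L = L} sΓ sΔ y with sΓ y | sΔ y
... | inj₁ Γy≡[] | inj₁ Δy≡[] = inj₁ (cong₂ _++_ Γy≡[] Δy≡[])
... | inj₂ y∈L  | _          = inj₂ (∈-++⁺ˡ y∈L)
... | inj₁ _    | inj₂ y∈K   = inj₂ (∈-++⁺ʳ L y∈K)

∖-support-∷ : ∀ {Γ x L} → SupportedIn Γ (x ∷ L) → SupportedIn (Γ ∖ x) L
∖-support-∷ {x = x} s y with y ≟ x | s y
... | yes _   | _                  = inj₁ refl
... | no _    | inj₁ Γy≡[]         = inj₁ Γy≡[]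
... | no y≢x  | inj₂ (here y≡x)    = ⊥-elim (y≢x y≡x)
... | no _    | inj₂ (there y∈L)   = inj₂ y∈L

∖-support : ∀ {Γ L} x → SupportedIn Γ L → SupportedIn (Γ ∖ x) L
∖-support x s = ∖-support-∷ {x = x} (λ y → map₂ there (s y))

≈E-support : ∀ {Γ Γ' L} → Γ ≈E Γ' → SupportedIn Γ L → SupportedIn Γ' L
≈E-support Γ≈Γ' s y = map₁ (≈M-[] (Γ≈Γ' y)) (s y)

mutual
  ⊢-support : ∀ {Γ t σ} → Γ ⊢ t ∶ σ → ∃ (SupportedIn Γ)
  ⊢-support (var {x} {σ}) = x ∷ [] , single-support x σ
  ⊢-support (abs {x = x} d) with ⊢-support d
  ... | L , s = L , ∖-support x s
  ⊢-support (app d e) with ⊢-support d | ⊢-support e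
  ... | L , s | K , r = L ++ K , +E-support s r
  ⊢-support (es {x = x} d e) with ⊢-support d | ⊢-support e
  ... | L , s | K , r = L ++ K , +E-support (∖-support x s) r
  ⊢-support (bg f) = BgFam-support f
  ⊢-support (dr d) = ⊢-support d
  ⊢-support (conv d Γ≈Γ' _) with ⊢-support d
  ... | L , s = L , ≈E-support Γ≈Γ' s

  BgFam-support : ∀ {Γ t M} → BgFam Γ t M → ∃ (SupportedIn Γ)
  BgFam-support bnil = [] , λ _ → inj₁ refl
  BgFam-support (bcons d f) with ⊢-support d | BgFam-support f
  ... | L , s | K , r = L ++ K , +E-support s r

SupportedIn-[]⇒≈∅ : ∀ {Γ} → SupportedIn Γ [] → Γ ≈E ∅
SupportedIn-[]⇒≈∅ s y with s y
... | inj₁ Γy≡[] = ≡⇒≈M Γy≡[]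

_∘T_ : TCtx → TCtx → TCtx
hole        ∘T T = T
tapp T' s   ∘T T = tapp (T' ∘T T) s
tred y T' s ∘T T = tred y (T' ∘T T) s

plug-∘T : ∀ T' T u → plug (T' ∘T T) u ≡ plug T' (plug T u)
plug-∘T hole          T u = refl
plug-∘T (tapp T' s)   T u = cong (λ v → app v s) (plug-∘T T' T u)
plug-∘T (tred y T' s) T u = cong (λ v → app (lam y v) s) (plug-∘T T' T u)

[]-inhabited : Inhabited (mul [])
[]-inhabited = bang (var 0) , bg bnil

ImageInhabited⇒Inhabited : ∀ {Γ} → ImageInhabited Γ → ∀ x → Inhabited (mul (Γ x))
ImageInhabited⇒Inhabited {Γ} h x with Γ x | h x
... | []    | _   = []-inhabited
... | _ ∷ _ | hx  = hx (λ ())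

ImageInhabited-∖ : ∀ {Γ} x → ImageInhabited Γ → ImageInhabited (Γ ∖ x)
ImageInhabited-∖ x h y Γy≢[] with y ≟ x
... | yes _ = ⊥-elim (Γy≢[] refl)
... | no _  = h y Γy≢[]

⊢-redex : ∀ {Γ u w x σ} → Γ ⊢ u ∶ σ → ∅ ⊢ w ∶ mul (Γ x) →
          (Γ ∖ x) ⊢ app (lam x u) w ∶ σ
⊢-redex {Γ} {x = x} {σ = σ} d e =
  conv (app (abs d) e) (λ y → ≡⇒≈M (++-identityʳ ((Γ ∖ x) y))) (≈T-refl σ)

close-support : ∀ L {Γ u σ} → Γ ⊢ u ∶ σ → SupportedIn Γ L → ImageInhabited Γ →
                Σ TCtx (λ T → ∅ ⊢ plug T u ∶ σ)
close-support [] {σ = σ} d s _ = hole , conv d (SupportedIn-[]⇒≈∅ s) (≈T-refl σ)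
close-support (x ∷ L) {u = u} {σ} d s h
  with w , ⊢w ← ImageInhabited⇒Inhabited h x
  with T , ⊢T ← close-support L (⊢-redex d ⊢w) (∖-support-∷ s) (ImageInhabited-∖ x h)
  = T ∘T tred x hole w , subst (λ v → ∅ ⊢ v ∶ σ) (sym (plug-∘T T (tred x hole w) u)) ⊢T

lemmaB1 : ∀ {Γ t σ} → Γ ⊢ t ∶ σ → ImageInhabited Γ →
    Σ TCtx (λ T → ∅ ⊢ plug T t ∶ σ) × Inhabited σ
lemmaB1 {t = t} d h
  with L , s ← ⊢-support d
  with T , ⊢T ← close-support L d s h
  = (T , ⊢T) , (plug T t , ⊢T)
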